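{- Let $S$ be a numerical semigroup with multiplicity $m$ and embedding dimension $\nu$, and let $\mathrm{Ap}(S,m)=\{w_0=0<w_1<\dots<w_{m-1}\}$. If $m-\nu\ge\frac{\alpha(\alpha-1)}{2}-1$ for some integer $\alpha$ with $3\le\alpha\le m-2$, then $w_{m-1}\ge w_1+w_\alpha$ or $w_{m-1}\ge w_{\alpha-2}+w_{\alpha-1}$.
   Context: A numerical semigroup is a submonoid of $(\mathbb N,+)$ with finite complement; $m$ is its smallest nonzero element and $\nu$ its minimal number of generators. $\mathrm{Ap}(S,m)=\{s\in S: s-m\notin S\}$, an $m$-element set listed increasingly. -}

module Defs where

open import Data.Nat using (ℕ; zero; suc; _+_; _*_; _∸_; _≤_; _<_)
open import Data.Bool using (Bool; T)
open import Data.List using (List; length)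
open import Data.List.Membership.Propositional using (_∈_)
open import Data.List.Relation.Unary.All using (All)
open import Data.Product using (Σ; ∃; _×_)
open import Relation.Nullary using (¬_)
open import Relation.Binary.PropositionalEquality using (_≡_)

record NumericalSemigroup : Set where
  field
    mem      : ℕ → Bool
    zero∈    : T (mem 0)
    closed   : ∀ a b → T (mem a) → T (mem b) → T (mem (a + b))
    cofinite : ∃ λ F → ∀ n → F < n → T (mem n)

_∈S_ : ℕ → NumericalSemigroup → Set
x ∈S S = T (NumericalSemigroup.mem S x)

IsMultiplicity : NumericalSemigroup → ℕ → Set
IsMultiplicity S m = (0 < m) × (m ∈S S) × (∀ k → 0 < k → k < m → ¬ (k ∈S S))

data InMonoid (gs : List ℕ) : ℕ → Set where
  mzero : InMonoid gs 0
  madd  : ∀ {g s} → g ∈ gs → InMonoid gs s → InMonoid gs (g + s)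

Generates : NumericalSemigroup → List ℕ → Set
Generates S gs = All (λ g → g ∈S S) gs × (∀ s → s ∈S S → InMonoid gs s)

IsEmbeddingDimension : NumericalSemigroup → ℕ → Set
IsEmbeddingDimension S ν =
  (∃ λ gs → Generates S gs × length gs ≡ ν) ×
  (∀ gs → Generates S gs → ν ≤ length gs)

InApery : NumericalSemigroup → ℕ → ℕ → Set
InApery S m x = (x ∈S S) × ¬ ((m ≤ x) × ((x ∸ m) ∈S S))

-- w_0 < w_1 < ... < w_{m-1} is the increasing enumeration of Ap(S,m)
-- (only the values w i for i < m are meaningful)
IsAperyEnumeration : NumericalSemigroup → ℕ → (ℕ → ℕ) → Set
IsAperyEnumeration S m w =
  (∀ i j → i < j → j < m → w i < w j) ×
  (∀ i → i < m → InApery S m (w i)) ×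
  (∀ x → InApery S m x → ∃ λ i → (i < m) × (w i ≡ x))

-- Suppose both inequalities fail, so that w_{α-2} + w_{α-1} > w_{m-1}. Summands of an Apéry
-- element are Apéry elements, so every w_k with k ≥ 1 is either a generator or a sum w_i + w_j
-- with 1 ≤ i ≤ j; and j ≤ α - 1, since otherwise w_k ≥ w_1 + w_α > w_{m-1}. Hence the m + 2
-- distinct numbers m, w_1, …, w_{m-1}, w_{α-2} + w_{α-1}, 2 w_{α-1} (the last two exceed w_{m-1})
-- lie among the ν generators and the α(α-1)/2 sums w_i + w_j with 1 ≤ i ≤ j ≤ α - 1, so
-- m + 2 ≤ ν + α(α-1)/2, contradicting the hypothesis.
module Submission where

open import Defs
open import Data.Nat using (ℕ; _+_; _*_; _∸_; _≤_; _<_)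
open import Data.Sum using (_⊎_)

open import Data.Nat using (zero; suc; s≤s; s≤s⁻¹; z≤n; z<s; _≤?_; _≟_)
open import Data.Nat.Properties
open import Data.Empty using (⊥; ⊥-elim)
open import Data.Fin using (zero; suc)
open import Data.Fin.Properties using (injective⇒≤)
open import Data.Product using (∃; ∃₂; _×_; _,_; proj₁; proj₂)
open import Data.Sum using (inj₁; inj₂)
open import Data.List using (List; []; _∷_; length; lookup; applyUpTo; _++_)
open import Data.List.Properties using (length-++; length-applyUpTo)
open import Data.List.Relation.Unary.All as All using (All; _∷_)
import Data.List.Relation.Unary.All.Properties as All
open import Data.List.Relation.Unary.AllPairs using (_∷_)
import Data.List.Relation.Unary.AllPairs.Properties as AllPairs
open import Data.List.Relation.Unary.Unique.Propositional using (Unique)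
open import Data.List.Relation.Binary.Subset.Propositional using (_⊆_)
open import Data.List.Membership.Propositional using (_∈_)
open import Data.List.Membership.Propositional.Properties using (∈-lookup; ∈-applyUpTo⁺; ∈-++⁺ˡ; ∈-++⁺ʳ)
import Data.List.Membership.Setoid.Properties as SetoidMembership
open import Function using (_∘_)
open import Function.Definitions using (Injective)
open import Relation.Nullary using (¬_; contradiction; yes; no)
open import Relation.Binary.PropositionalEquality

lookup-injective : {xs : List ℕ} → Unique xs → Injective _≡_ _≡_ (lookup xs)
lookup-injective (_  ∷ _) {zero}  {zero}  _  = refl
lookup-injective (x∉ ∷ _) {zero}  {suc j} eq = contradiction eq (All.lookup x∉ (∈-lookup j))
lookup-injective (x∉ ∷ _) {suc i} {zero}  eq = contradiction (sym eq) (All.lookup x∉ (∈-lookup i))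
lookup-injective (_  ∷ u) {suc i} {suc j} eq = cong suc (lookup-injective u eq)

Unique∧⊆⇒length≤ : {xs ys : List ℕ} → Unique xs → xs ⊆ ys → length xs ≤ length ys
Unique∧⊆⇒length≤ u xs⊆ys = injective⇒≤ λ {i} {j} eq →
  lookup-injective u
    (SetoidMembership.index-injective (setoid ℕ) (xs⊆ys (∈-lookup i)) (xs⊆ys (∈-lookup j)) eq)

pairSums : (ℕ → ℕ) → ℕ → List ℕ
pairSums f zero    = []
pairSums f (suc n) = applyUpTo (λ i → f (suc i) + f (suc n)) (suc n) ++ pairSums f n

length-pairSums : ∀ f n → 2 * length (pairSums f n) ≡ n * suc n
length-pairSums f zero    = refl
length-pairSums f (suc n) = begin
  2 * length (row ++ pairSums f n)     ≡⟨ cong (2 *_) (length-++ row) ⟩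
  2 * (length row + length rest)       ≡⟨ cong (λ l → 2 * (l + length rest)) (length-applyUpTo sumWith (suc n)) ⟩
  2 * (suc n + length rest)            ≡⟨ *-distribˡ-+ 2 (suc n) (length rest) ⟩
  2 * suc n + 2 * length rest          ≡⟨ cong (2 * suc n +_) (length-pairSums f n) ⟩
  2 * suc n + n * suc n                ≡⟨ *-distribʳ-+ (suc n) 2 n ⟨
  suc (suc n) * suc n                  ≡⟨ *-comm (suc (suc n)) (suc n) ⟩
  suc n * suc (suc n)                  ∎
  where
  open ≡-Reasoning
  sumWith = λ i → f (suc i) + f (suc n)
  row     = applyUpTo sumWith (suc n)
  rest    = pairSums f n

∈-pairSums : ∀ f {n i j} → 1 ≤ i → i ≤ j → j ≤ n → f i + f j ∈ pairSums f n
∈-pairSums f {zero}  {suc _} {zero} _ () _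
∈-pairSums f {suc n} {suc i} {j} 1≤i i≤j j≤n with j ≟ suc n
... | yes refl = ∈-++⁺ˡ (∈-applyUpTo⁺ (λ i → f (suc i) + f (suc n)) i≤j)
... | no j≢n   = ∈-++⁺ʳ _ (∈-pairSums f 1≤i i≤j (≤-pred (≤∧≢⇒< j≤n j≢n)))

module _ (S : NumericalSemigroup) where
  open NumericalSemigroup S

  InMonoid⇒∈S : ∀ {gs x} → All (_∈S S) gs → InMonoid gs x → x ∈S S
  InMonoid⇒∈S gs⊆S mzero      = zero∈
  InMonoid⇒∈S gs⊆S (madd g r) = closed _ _ (All.lookup gs⊆S g) (InMonoid⇒∈S gs⊆S r)

  PositiveSum : ℕ → Set
  PositiveSum x = ∃₂ λ a b → (0 < a × a ∈S S) × (0 < b × b ∈S S) × x ≡ a + b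

  generator-or-positiveSum : ∀ {gs x} → All (_∈S S) gs → InMonoid gs x → 0 < x →
                             x ∈ gs ⊎ PositiveSum x
  generator-or-positiveSum gs⊆S (madd {zero} _ r) x>0 = generator-or-positiveSum gs⊆S r x>0
  generator-or-positiveSum {gs} _ (madd {suc _} {zero} g _) _ =
    inj₁ (subst (_∈ gs) (sym (+-identityʳ _)) g)
  generator-or-positiveSum gs⊆S (madd {suc _} {suc _} g r) _ =
    inj₂ (_ , _ , (z<s , All.lookup gs⊆S g) , (z<s , InMonoid⇒∈S gs⊆S r) , refl)

module AperyEnumeration (S : NumericalSemigroup) {m : ℕ} {w : ℕ → ℕ}
         (mult : IsMultiplicity S m) (ap : IsAperyEnumeration S m w) where
  open NumericalSemigroup S

  w-increasing : ∀ {i j} → i < j → j < m → w i < w j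
  w-increasing = proj₁ ap _ _

  private
    w∈Ap = proj₁ (proj₂ ap)
    Ap⊆w = proj₂ (proj₂ ap)

  multiplicity≤ : ∀ {a} → a ∈S S → 0 < a → m ≤ a
  multiplicity≤ {a} a∈S a>0 with m ≤? a
  ... | yes m≤a = m≤a
  ... | no  m≰a = contradiction a∈S (proj₂ (proj₂ mult) a a>0 (≰⇒> m≰a))

  w-mono : ∀ {i j} → i ≤ j → j < m → w i ≤ w j
  w-mono {i} {j} i≤j j<m with m≤n⇒m<n∨m≡n i≤j
  ... | inj₁ i<j  = <⇒≤ (w-increasing i<j j<m)
  ... | inj₂ refl = ≤-refl

  w0≡0 : w 0 ≡ 0
  w0≡0 with Ap⊆w 0 (zero∈ , λ (m≤0 , _) → <⇒≱ (proj₁ mult) m≤0)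
  ... | zero  , _   , w0≡0 = w0≡0
  ... | suc i , i<m , wi≡0 = contradiction (subst (w 0 <_) wi≡0 (w-increasing z<s i<m)) n≮0

  w-positive : ∀ {k} → 1 ≤ k → k < m → 0 < w k
  w-positive {k} 1≤k k<m = subst (_< w k) w0≡0 (w-increasing 1≤k k<m)

  m≤w : ∀ {k} → 1 ≤ k → k < m → m ≤ w k
  m≤w 1≤k k<m = multiplicity≤ (proj₁ (w∈Ap _ k<m)) (w-positive 1≤k k<m)

  m≢w : ∀ {k} → k < m → m ≢ w k
  m≢w k<m refl = proj₂ (w∈Ap _ k<m) (≤-refl , subst (_∈S S) (sym (n∸n≡0 m)) zero∈)

  InApery-summand : ∀ {x a b} → InApery S m x → x ≡ a + b → a ∈S S → b ∈S S → InApery S m a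
  InApery-summand {a = a} {b} (_ , x∉m+S) refl a∈S b∈S = a∈S , λ (m≤a , a∸m∈S) →
    x∉m+S (≤-trans m≤a (m≤m+n a b) , subst (_∈S S) (sym (+-∸-comm b m≤a)) (closed _ _ a∸m∈S b∈S))

  positive-apery-index : ∀ {x} → 0 < x → InApery S m x → ∃ λ i → 1 ≤ i × i < m × w i ≡ x
  positive-apery-index x>0 x∈Ap with Ap⊆w _ x∈Ap
  ... | zero  , _   , w0≡x = contradiction (subst (0 <_) (trans (sym w0≡x) w0≡0) x>0) n≮0
  ... | suc i , i<m , wi≡x = suc i , s≤s z≤n , i<m , wi≡x

  m∈generators : ∀ {gs} → Generates S gs → m ∈ gs
  m∈generators (gs⊆S , gen)
    with generator-or-positiveSum S gs⊆S (gen m (proj₁ (proj₂ mult))) (proj₁ mult)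
  ... | inj₁ m∈gs = m∈gs
  ... | inj₂ (a , b , (a>0 , a∈S) , (b>0 , b∈S) , m≡a+b) =
    contradiction m≡a+b (<⇒≢ (<-≤-trans (m<m+n m (<-≤-trans (proj₁ mult) (multiplicity≤ b∈S b>0)))
                                        (+-monoˡ-≤ b (multiplicity≤ a∈S a>0))))

  generator-or-apery-sum : ∀ {gs k} → Generates S gs → 1 ≤ k → k < m →
    w k ∈ gs ⊎ ∃₂ λ i j → 1 ≤ i × i ≤ j × j < m × w k ≡ w i + w j
  generator-or-apery-sum (gs⊆S , gen) 1≤k k<m
    with generator-or-positiveSum S gs⊆S (gen _ (proj₁ (w∈Ap _ k<m))) (w-positive 1≤k k<m)
  ... | inj₁ wk∈gs = inj₁ wk∈gs
  ... | inj₂ (a , b , (a>0 , a∈S) , (b>0 , b∈S) , wk≡a+b)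
    with positive-apery-index a>0 (InApery-summand (w∈Ap _ k<m) wk≡a+b a∈S b∈S)
       | positive-apery-index b>0 (InApery-summand (w∈Ap _ k<m) (trans wk≡a+b (+-comm a b)) b∈S a∈S)
  ... | i , 1≤i , i<m , wi≡a | j , 1≤j , j<m , wj≡b with ≤-total i j
  ...   | inj₁ i≤j = inj₂ (i , j , 1≤i , i≤j , j<m ,
                             trans wk≡a+b (cong₂ _+_ (sym wi≡a) (sym wj≡b)))
  ...   | inj₂ j≤i = inj₂ (j , i , 1≤j , j≤i , i<m ,
                             trans wk≡a+b (trans (+-comm a b) (cong₂ _+_ (sym wj≡b) (sym wi≡a))))

module _ (S : NumericalSemigroup) {t : ℕ} {w : ℕ → ℕ}
         (mult : IsMultiplicity S (suc t)) (ap : IsAperyEnumeration S (suc t) w)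
         {gs : List ℕ} (gen : Generates S gs)
         {k : ℕ} (1≤k : 1 ≤ k) (k+2<t : suc (suc k) < t) where
  open AperyEnumeration S mult ap

  apery-count : ¬ (w 1 + w (suc (suc k)) ≤ w t) → ¬ (w k + w (suc k) ≤ w t) →
                3 + t ≤ length gs + length (pairSums w (suc k))
  apery-count ¬short ¬long =
    subst₂ _≤_ (cong (3 +_) (length-applyUpTo (w ∘ suc) t)) (length-++ gs)
      (Unique∧⊆⇒length≤ unique (All.lookup ⊆A))
    where
    A  = gs ++ pairSums w (suc k)
    ws = applyUpTo (w ∘ suc) t
    s₁ = w k + w (suc k)
    s₂ = w (suc k) + w (suc k)

    suc-k<m : suc k < suc t
    suc-k<m = <-trans (n<1+n (suc k)) (m<n⇒m<1+n k+2<t)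

    w≤w-top : ∀ {i} → i < suc t → w i ≤ w t
    w≤w-top i<m = w-mono (s≤s⁻¹ i<m) ≤-refl

    w-top<s₁ : w t < s₁
    w-top<s₁ = ≰⇒> ¬long

    s₁<s₂ : s₁ < s₂
    s₁<s₂ = +-monoˡ-< (w (suc k)) (w-increasing (n<1+n k) suc-k<m)

    w-top<s₂ : w t < s₂
    w-top<s₂ = <-trans w-top<s₁ s₁<s₂

    below-top : All (_≤ w t) (suc t ∷ ws)
    below-top = m≤w (<-trans (s≤s z≤n) (<-trans (n<1+n (suc k)) k+2<t)) (n<1+n t)
              ∷ All.applyUpTo⁺₁ (w ∘ suc) t (λ i<t → w≤w-top (s≤s i<t))

    unique : Unique (s₂ ∷ s₁ ∷ suc t ∷ ws)
    unique = (>⇒≢ s₁<s₂ ∷ All.map (λ x≤w-top → >⇒≢ (≤-<-trans x≤w-top w-top<s₂)) below-top)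
           ∷ All.map (λ x≤w-top → >⇒≢ (≤-<-trans x≤w-top w-top<s₁)) below-top
           ∷ All.applyUpTo⁺₁ (w ∘ suc) t (λ i<t → m≢w (s≤s i<t))
           ∷ AllPairs.applyUpTo⁺₁ (w ∘ suc) t (λ i<j j<t → <⇒≢ (w-increasing (s≤s i<j) (s≤s j<t)))

    ∈A : ∀ {i} → 1 ≤ i → i < suc t → w i ∈ A
    ∈A {i} 1≤i i<m with generator-or-apery-sum gen 1≤i i<m
    ... | inj₁ wi∈gs = ∈-++⁺ˡ wi∈gs
    ... | inj₂ (i₁ , i₂ , 1≤i₁ , i₁≤i₂ , i₂<m , wi≡sum) with i₂ ≤? suc k
    ...   | yes i₂≤k+1 = subst (_∈ A) (sym wi≡sum) (∈-++⁺ʳ gs (∈-pairSums w 1≤i₁ i₁≤i₂ i₂≤k+1))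
    ...   | no  i₂≰k+1 = contradiction (begin
            w 1 + w (suc (suc k)) ≤⟨ +-mono-≤ (w-mono 1≤i₁ (≤-<-trans i₁≤i₂ i₂<m))
                                               (w-mono (≰⇒> i₂≰k+1) i₂<m) ⟩
            w i₁ + w i₂           ≡⟨ sym wi≡sum ⟩
            w i                   ≤⟨ w≤w-top i<m ⟩
            w t                   ∎) ¬short
      where open ≤-Reasoning

    ⊆A : All (_∈ A) (s₂ ∷ s₁ ∷ suc t ∷ ws)
    ⊆A = ∈-++⁺ʳ gs (∈-pairSums w (s≤s z≤n) ≤-refl ≤-refl)
       ∷ ∈-++⁺ʳ gs (∈-pairSums w 1≤k (n≤1+n k) ≤-refl)
       ∷ ∈-++⁺ˡ (m∈generators gen)
       ∷ All.applyUpTo⁺₁ (w ∘ suc) t (λ i<t → ∈A (s≤s z≤n) (s≤s i<t))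

pairSums-count-contradiction : ∀ {t ν} (f : ℕ → ℕ) k →
                               3 + t ≤ ν + length (pairSums f (suc k)) →
                               suc (suc k) * suc k + 2 * ν ≤ 2 * suc t + 2 → ⊥
pairSums-count-contradiction {t} {ν} f k count hyp =
  contradiction (+-cancelˡ-≤ (2 * suc t) 4 2 (begin
    2 * suc t + 4                ≡⟨ *-distribˡ-+ 2 (suc t) 2 ⟨
    2 * (suc t + 2)              ≡⟨ cong (2 *_) (+-comm (suc t) 2) ⟩
    2 * (3 + t)                  ≤⟨ *-monoʳ-≤ 2 count ⟩
    2 * (ν + P)                  ≡⟨ *-distribˡ-+ 2 ν P ⟩
    2 * ν + 2 * P                ≡⟨ cong (2 * ν +_) (length-pairSums f (suc k)) ⟩
    2 * ν + suc k * suc (suc k)  ≡⟨ cong (2 * ν +_) (*-comm (suc k) (suc (suc k))) ⟩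
    2 * ν + suc (suc k) * suc k  ≡⟨ +-comm (2 * ν) _ ⟩
    suc (suc k) * suc k + 2 * ν  ≤⟨ hyp ⟩
    2 * suc t + 2                ∎))
    λ { (s≤s (s≤s ())) }
  where
  open ≤-Reasoning
  P = length (pairSums f (suc k))

lemma4 : (S : NumericalSemigroup) (m ν : ℕ) (w : ℕ → ℕ) →
         IsMultiplicity S m → IsEmbeddingDimension S ν →
         IsAperyEnumeration S m w →
         (α : ℕ) → 3 ≤ α → α ≤ m ∸ 2 →
         α * (α ∸ 1) + 2 * ν ≤ 2 * m + 2 →
         (w 1 + w α ≤ w (m ∸ 1)) ⊎ (w (α ∸ 2) + w (α ∸ 1) ≤ w (m ∸ 1))
lemma4 _ _             _ _ _ _ _ zero                ()             _  _
lemma4 _ _             _ _ _ _ _ (suc zero)          (s≤s ())       _  _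
lemma4 _ _             _ _ _ _ _ (suc (suc zero))    (s≤s (s≤s ())) _  _
lemma4 _ zero          _ _ _ _ _ (suc (suc (suc _))) _              () _
lemma4 _ (suc zero)    _ _ _ _ _ (suc (suc (suc _))) _              () _
lemma4 S (suc (suc m₂)) _ w mult ((gs , gen , refl) , _) ap (suc (suc (suc k))) _ α≤m∸2 hyp
  with w 1 + w (3 + k) ≤? w (suc m₂) | w (suc k) + w (2 + k) ≤? w (suc m₂)
... | yes short | _        = inj₁ short
... | no _      | yes long = inj₂ long
... | no ¬short | no ¬long =
  ⊥-elim (pairSums-count-contradiction w (suc k)
           (apery-count S mult ap gen (s≤s z≤n) (s≤s α≤m∸2) ¬short ¬long) hyp)
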